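{- Let $\mathcal M=(E,\rho)$ be a $q$-matroid on an $n$-dimensional $\mathbb F_q$-vector space $E$ with $\kappa(\mathcal M)=t$, and let $(A,V)$ be a vertical $t$-separation of $\mathcal M$. Let $s=\dim A$ and fix a basis $\beta=\{a_1,\dots,a_s,v_{s+1},\dots,v_n\}$ of $E$ such that $\{a_1,\dots,a_s\}$ is a basis of $A$ and $\{v_{s+1},\dots,v_n\}$ is a basis of $V$. Define $r:2^\beta\to\mathbb N$ by $r(X)=\rho(\langle X\rangle)$, where $\langle X\rangle$ is the $\mathbb F_q$-span of $X$. Then $M=(\beta,r)$ is a matroid and its vertical connectivity equals $\kappa(\mathcal M)$.
   Context: A $q$-matroid is a pair $(E,\rho)$ with $E$ a finite-dimensional $\mathbb F_q$-space and $\rho$ a function from subspaces of $E$ to $\mathbb N$ satisfying $\rho(V)\le\dim V$, $V\le W\Rightarrow\rho(V)\le\rho(W)$, and $\rho(V\cap W)+\rho(V+W)\le\rho(V)+\rho(W)$. A pair $(A,V)$ of subspaces of $E$ is a vertical $t$-separation of the $q$-matroid if $A\cap V=\{0\}$, $A+V=E$, $\min\{\rho(A),\rho(V)\}\ge t$ and $\rho(A)+\rho(V)-\rho(E)<t$; $\kappa(\mathcal M)$ is the minimum $t$ with a vertical $t$-separation, or $\rho(E)$ if none exists. A (classical) matroid is a pair $(E,r)$ with $E$ finite and $r:2^E\to\mathbb N$ satisfying $0\le r(X)\le|X|$, monotonicity, and submodularity. For a matroid, a partition $(X,E\setminus X)$ is a vertical $t$-separation if $r(X)+r(E\setminus X)-r(E)<t$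 and $\min\{r(X),r(E\setminus X)\}\ge t$; the vertical connectivity is the minimum such $t$, or $r(E)$ if no vertical separation exists. -}

module Defs where

open import Level using (Level; _⊔_) renaming (suc to lsuc)
open import Algebra.Bundles using (CommutativeRing)
import Algebra.Properties.CommutativeSemigroup as CSProps
open import Data.Nat using (ℕ; zero; suc; _+_; _≤_; _<_; _<ᵇ_)
open import Data.Fin using (Fin; toℕ) renaming (zero to fzero; suc to fsuc)
open import Data.Fin.Subset using (Subset; _∈_; _∉_; _⊆_; ∁; ∣_∣; _∪_; _∩_; ⊤)
open import Data.Vec using (tabulate)
open import Data.Product using (Σ; ∃; _×_; _,_; proj₁; proj₂)
open import Data.Sum using (_⊎_)
open import Relation.Nullary using (¬_)
open import Relation.Binary.PropositionalEquality using (_≡_)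

record FiniteField (c ℓ : Level) : Set (lsuc (c ⊔ ℓ)) where
  field
    commRing : CommutativeRing c ℓ
  open CommutativeRing commRing public
  field
    1≉0       : ¬ (1# ≈ 0#)
    inverse   : ∀ x → ¬ (x ≈ 0#) → ∃ λ y → x * y ≈ 1#
    q         : ℕ
    enum      : Fin q → Carrier
    enum-surj : ∀ x → ∃ λ i → enum i ≈ x
    enum-inj  : ∀ i j → enum i ≈ enum j → i ≡ j

module QSpace {c ℓ : Level} (F : FiniteField c ℓ) (n : ℕ) where
  open FiniteField F renaming (_+_ to _+K_; _*_ to _*K_)
  open CSProps *-commutativeSemigroup using () renaming (interchange to *-interchange)
  open CSProps +-commutativeSemigroup using (interchange)

  Vec : Set c
  Vec = Fin n → Carrier

  _≈v_ : Vec → Vec → Set ℓ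
  x ≈v y = ∀ j → x j ≈ y j

  0v : Vec
  0v _ = 0#

  _+v_ : Vec → Vec → Vec
  (x +v y) j = x j +K y j

  _•v_ : Carrier → Vec → Vec
  (a •v x) j = a *K x j

  ΣK : ∀ {k} → (Fin k → Carrier) → Carrier
  ΣK {zero}  f = 0#
  ΣK {suc k} f = f fzero +K ΣK (λ i → f (fsuc i))

  lin : ∀ {k} → (Fin k → Carrier) → (Fin k → Vec) → Vec
  lin coef b j = ΣK (λ i → coef i *K b i j)

  private
    ΣK-+ : ∀ {k} (f g : Fin k → Carrier) → ΣK f +K ΣK g ≈ ΣK (λ i → f i +K g i)
    ΣK-+ {zero} f g = +-identityˡ 0#
    ΣK-+ {suc k} f g = trans (interchange _ _ _ _)
      (+-congˡ (ΣK-+ (λ i → f (fsuc i)) (λ i → g (fsuc i))))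

    ΣK-* : ∀ {k} a (f : Fin k → Carrier) → a *K ΣK f ≈ ΣK (λ i → a *K f i)
    ΣK-* {zero} a f = zeroʳ a
    ΣK-* {suc k} a f = trans (distribˡ a _ _) (+-congˡ (ΣK-* a (λ i → f (fsuc i))))

    ΣK-cong : ∀ {k} {f g : Fin k → Carrier} → (∀ i → f i ≈ g i) → ΣK f ≈ ΣK g
    ΣK-cong {zero} e = refl
    ΣK-cong {suc k} e = +-cong (e fzero) (ΣK-cong (λ i → e (fsuc i)))

  record Subspace : Set (lsuc (c ⊔ ℓ)) where
    field
      pred  : Vec → Set (c ⊔ ℓ)
      resp  : ∀ {x y} → x ≈v y → pred x → pred y
      has0  : pred 0v
      add   : ∀ {x y} → pred x → pred y → pred (x +v y)
      scale : ∀ a {x} → pred x → pred (a •v x)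
  open Subspace public

  _⊆S_ : Subspace → Subspace → Set (c ⊔ ℓ)
  V ⊆S W = ∀ x → pred V x → pred W x

  fullS : Subspace
  fullS = record
    { pred = λ _ → Level.Lift (c ⊔ ℓ) Data.Unit.⊤
    ; resp = λ _ _ → _ ; has0 = _ ; add = λ _ _ → _ ; scale = λ _ _ → _ }
    where import Data.Unit

  zeroS : Subspace
  zeroS = record
    { pred  = λ x → Level.Lift c (x ≈v 0v)
    ; resp  = λ { e (Level.lift p) → Level.lift (λ j → trans (sym (e j)) (p j)) }
    ; has0  = Level.lift (λ _ → refl)
    ; add   = λ { (Level.lift p) (Level.lift p') → Level.lift (λ j → trans (+-cong (p j) (p' j)) (+-identityˡ 0#)) }
    ; scale = λ { a (Level.lift p) → Level.lift (λ j → trans (*-congˡ (p j)) (zeroʳ a)) }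
    }

  _∩S_ : Subspace → Subspace → Subspace
  V ∩S W = record
    { pred  = λ x → pred V x × pred W x
    ; resp  = λ e (p , p') → resp V e p , resp W e p'
    ; has0  = has0 V , has0 W
    ; add   = λ (p , p') (r , r') → add V p r , add W p' r'
    ; scale = λ a (p , p') → scale V a p , scale W a p'
    }

  _+S_ : Subspace → Subspace → Subspace
  V +S W = record
    { pred  = λ x → ∃ λ v → ∃ λ w → pred V v × pred W w × x ≈v (v +v w)
    ; resp  = λ { e (v , w , pv , pw , ex) → v , w , pv , pw , (λ j → trans (sym (e j)) (ex j)) }
    ; has0  = 0v , 0v , has0 V , has0 W , (λ _ → sym (+-identityˡ 0#))
    ; add   = λ { (v , w , pv , pw , ex) (v' , w' , pv' , pw' , ex') →
                  (v +v v') , (w +v w') , add V pv pv' , add W pw pw' ,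
                  (λ j → trans (+-cong (ex j) (ex' j)) (interchange _ _ _ _)) }
    ; scale = λ { a (v , w , pv , pw , ex) →
                  (a •v v) , (a •v w) , scale V a pv , scale W a pw ,
                  (λ j → trans (*-congˡ (ex j)) (distribˡ a _ _)) }
    }

  SpanIn : ∀ {k} → (Fin k → Vec) → Subset k → Subspace
  SpanIn {k} b X = record
    { pred  = λ x → Level.Lift (c ⊔ ℓ) (∃ λ (coef : Fin k → Carrier) → (∀ i → i ∉ X → coef i ≈ 0#) × x ≈v lin coef b)
    ; resp  = λ { e (Level.lift (coef , z , ex)) → Level.lift (coef , z , λ j → trans (sym (e j)) (ex j)) }
    ; has0  = Level.lift ((λ _ → 0#) , (λ _ _ → refl) ,
                λ j → trans (sym (zeroˡ (ΣK (λ i → b i j))))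
                        (ΣK-* {k} 0# (λ i → b i j)))
    ; add   = λ { (Level.lift (coef , z , ex)) (Level.lift (coef' , z' , ex')) →
                  Level.lift ((λ i → coef i +K coef' i) ,
                    (λ i i∉ → trans (+-cong (z i i∉) (z' i i∉)) (+-identityˡ 0#)) ,
                    λ j → trans (+-cong (ex j) (ex' j))
                      (trans (ΣK-+ {k} (λ i → coef i *K b i j) (λ i → coef' i *K b i j)) (ΣK-cong {k} (λ i → sym (distribʳ (b i j) (coef i) (coef' i)))))) }
    ; scale = λ { a (Level.lift (coef , z , ex)) →
                  Level.lift ((λ i → a *K coef i) ,
                    (λ i i∉ → trans (*-congˡ (z i i∉)) (zeroʳ a)) ,
                    λ j → trans (*-congˡ (ex j))
                      (trans (ΣK-* {k} a (λ i → coef i *K b i j)) (ΣK-cong {k} (λ i → sym (*-assoc a (coef i) (b i j)))))) }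
    }

  Span : ∀ {k} → (Fin k → Vec) → Subspace
  Span b = SpanIn b ⊤

  IndependentIn : ∀ {k} → (Fin k → Vec) → Subset k → Set (c ⊔ ℓ)
  IndependentIn {k} b X = ∀ (coef : Fin k → Carrier) → (∀ i → i ∉ X → coef i ≈ 0#) →
                          lin coef b ≈v 0v → ∀ i → coef i ≈ 0#

  Independent : ∀ {k} → (Fin k → Vec) → Set (c ⊔ ℓ)
  Independent b = IndependentIn b ⊤

  IsBasisIn : ∀ {k} → Subspace → (Fin k → Vec) → Subset k → Set (c ⊔ ℓ)
  IsBasisIn W b X = (∀ i → i ∈ X → pred W (b i)) × IndependentIn b X × (W ⊆S SpanIn b X)

  HasDim : Subspace → ℕ → Set (c ⊔ ℓ)
  HasDim W k = ∃ λ (b : Fin k → Vec) → IsBasisIn W b ⊤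

  record IsQMatroid (ρ : Subspace → ℕ) : Set (lsuc (c ⊔ ℓ)) where
    field
      rank-≤-dim : ∀ V k → HasDim V k → ρ V ≤ k
      rank-mono  : ∀ V W → V ⊆S W → ρ V ≤ ρ W
      rank-submod : ∀ V W → ρ (V ∩S W) + ρ (V +S W) ≤ ρ V + ρ W

  -- vertical t-separation (A,V):  ρ(A)+ρ(V)-ρ(E) < t  written as  ρ(A)+ρ(V) < t+ρ(E)
  VertSepQ : (Subspace → ℕ) → ℕ → Subspace → Subspace → Set (c ⊔ ℓ)
  VertSepQ ρ t A V =
    ((A ∩S V) ⊆S zeroS) × (fullS ⊆S (A +S V)) ×
    (t ≤ ρ A) × (t ≤ ρ V) × (ρ A + ρ V < t + ρ fullS)

  IsKappa : (Subspace → ℕ) → ℕ → Set (lsuc (c ⊔ ℓ))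
  IsKappa ρ t =
    ((∃ λ A → ∃ λ V → VertSepQ ρ t A V) × (∀ t' A V → VertSepQ ρ t' A V → t ≤ t'))
    ⊎ ((∀ t' A V → ¬ VertSepQ ρ t' A V) × t ≡ ρ fullS)

  -- the subset {i | i < s} of indices (the a_1..a_s part of β)
  firstS : ℕ → Subset n
  firstS s = tabulate (λ i → toℕ i <ᵇ s)

record IsMatroid {m : ℕ} (r : Subset m → ℕ) : Set where
  field
    r-≤-card : ∀ X → r X ≤ ∣ X ∣
    r-mono   : ∀ X Y → X ⊆ Y → r X ≤ r Y
    r-submod : ∀ X Y → r (X ∩ Y) + r (X ∪ Y) ≤ r X + r Y

VertSepM : ∀ {m} → (Subset m → ℕ) → ℕ → Subset m → Set
VertSepM r t X = (r X + r (∁ X) < t + r ⊤) × (t ≤ r X) × (t ≤ r (∁ X))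

IsVertConn : ∀ {m} → (Subset m → ℕ) → ℕ → Set
IsVertConn r k =
  ((∃ λ X → VertSepM r k X) × (∀ t X → VertSepM r t X → k ≤ t))
  ⊎ ((∀ t X → ¬ VertSepM r t X) × k ≡ r ⊤)

{-# OPTIONS --safe #-}
module Submission where

-- r(X) = ρ⟨X⟩ inherits monotonicity from ρ, and submodularity because ⟨X ∩ Y⟩ ⊆ ⟨X⟩ ∩ ⟨Y⟩ and
-- ⟨X ∪ Y⟩ ⊆ ⟨X⟩ + ⟨Y⟩; r(X) ≤ |X| follows by removing one basis vector at a time, as ρ is
-- subadditive on sums and a single basis vector spans a line.  Since β is a basis, every partition
-- (X, β ∖ X) spans a decomposition E = ⟨X⟩ ⊕ ⟨β ∖ X⟩ with the same ranks, so a vertical separation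
-- of M is one of 𝓜; conversely (A, V) is spanned by the first s and the remaining vectors of β.
-- Hence t = κ(𝓜) is also the least order of a vertical separation of M.

open import Defs
open import Level using (Level; lift)
open import Data.Nat using (ℕ; zero; suc; _+_; _≤_; _<_; z≤n)
open import Data.Nat.Properties
  using (≤-antisym; ≤-trans; m≤n+m; +-mono-≤; +-comm; module ≤-Reasoning)
open import Data.Fin using (Fin; _≟_) renaming (zero to fzero; suc to fsuc)
open import Data.Fin.Properties using (suc-injective)
open import Data.Fin.Subset
  using (Subset; _∈_; _∉_; _⊆_; _⊂_; ∁; ⊤; ∣_∣; _∪_; _∩_; ⁅_⁆; _-_; Empty)
open import Data.Fin.Subset.Properties
  using (_∈?_; nonempty?; ∈⊤; x∈⁅x⁆; x≢y⇒x∉⁅y⁆; x∈p∪q⁺; x∈p∪q⁻; p∩q⊆p; p∩q⊆q; p∪∁p≡⊤;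
         ⊆-refl; ⊆-reflexive; x∈p⇒x∉∁p; x∉p⇒x∈∁p; x∈∁p⇒x∉p; x∈p∧x≢y⇒x∈p-y; x∈p⇒p-x⊂p;
         x∈p⇒∣p-x∣<∣p∣)
open import Data.Fin.Subset.Induction using (Acc; acc; ⊂-wellFounded)
open import Data.Product using (_×_; _,_; proj₁; proj₂)
open import Data.Sum using (inj₁; inj₂; [_,_]′)
open import Data.Empty using (⊥-elim)
open import Function using (_∘_)
open import Relation.Nullary using (yes; no)
open import Relation.Binary.PropositionalEquality as ≡ using (_≡_; _≢_)
import Algebra.Properties.Group as GroupProperties
import Algebra.Properties.Ring as RingProperties
import Relation.Binary.Reasoning.Setoid

p⊆p-x∪⁅x⁆ : ∀ {m} (p : Subset m) x → p ⊆ (p - x) ∪ ⁅ x ⁆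
p⊆p-x∪⁅x⁆ p x {y} y∈p with y ≟ x
... | yes ≡.refl = x∈p∪q⁺ (inj₂ (x∈⁅x⁆ y))
... | no  y≢x    = x∈p∪q⁺ (inj₁ (x∈p∧x≢y⇒x∈p-y y∈p y≢x))

module SpanRank {c ℓ : Level} (F : FiniteField c ℓ) (n : ℕ) where
  open QSpace F n
  open FiniteField F
    using (Carrier; _≈_; refl; sym; trans; 0#; 1#; -_; +-cong; +-congˡ; +-congʳ; *-congʳ;
           +-identityˡ; +-identityʳ; zeroˡ; zeroʳ; distribˡ; distribʳ; *-assoc; *-identityˡ;
           -‿inverseʳ; +-commutativeSemigroup; +-group; ring; setoid)
    renaming (_+_ to _+K_; _*_ to _*K_)
  open import Algebra.Properties.CommutativeSemigroup +-commutativeSemigroup using (interchange)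
  open GroupProperties +-group using (x∙y⁻¹≈ε⇒x≈y)
  open RingProperties ring using (-1*x≈-x)
  module ≈-Reasoning = Relation.Binary.Reasoning.Setoid setoid

  private
    variable
      k : ℕ
      b : Fin k → Vec
      X Y Z : Subset k
      coef coef′ : Fin k → Carrier
      W : Subspace

  ΣK-cong : {f g : Fin k → Carrier} → (∀ i → f i ≈ g i) → ΣK f ≈ ΣK g
  ΣK-cong {zero}  e = refl
  ΣK-cong {suc k} e = +-cong (e fzero) (ΣK-cong (λ i → e (fsuc i)))

  ΣK-+ : (f g : Fin k → Carrier) → ΣK f +K ΣK g ≈ ΣK (λ i → f i +K g i)
  ΣK-+ {zero}  f g = +-identityˡ 0#
  ΣK-+ {suc k} f g =
    trans (interchange _ _ _ _) (+-congˡ (ΣK-+ (λ i → f (fsuc i)) (λ i → g (fsuc i))))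

  ΣK-* : ∀ a (f : Fin k → Carrier) → a *K ΣK f ≈ ΣK (λ i → a *K f i)
  ΣK-* {zero}  a f = zeroʳ a
  ΣK-* {suc k} a f = trans (distribˡ a _ _) (+-congˡ (ΣK-* a (λ i → f (fsuc i))))

  ΣK-zero : {f : Fin k → Carrier} → (∀ i → f i ≈ 0#) → ΣK f ≈ 0#
  ΣK-zero {zero}  e = refl
  ΣK-zero {suc k} e = trans (+-cong (e fzero) (ΣK-zero (λ i → e (fsuc i)))) (+-identityˡ 0#)

  ΣK-single : {f : Fin k → Carrier} (i : Fin k) → (∀ j → j ≢ i → f j ≈ 0#) → ΣK f ≈ f i
  ΣK-single {suc k} fzero    e = trans (+-congˡ (ΣK-zero (λ j → e (fsuc j) λ ()))) (+-identityʳ _)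
  ΣK-single {suc k} (fsuc i) e =
    trans (+-congʳ (e fzero λ ()))
      (trans (+-identityˡ _) (ΣK-single i (λ j j≢i → e (fsuc j) (j≢i ∘ suc-injective))))

  lin-cong : ∀ {k} {coef coef′ : Fin k → Carrier} (b : Fin k → Vec) →
             (∀ i → coef i ≈ coef′ i) → lin coef b ≈v lin coef′ b
  lin-cong b e j = ΣK-cong (λ i → *-congʳ (e i))

  lin-+ : ∀ {k} {coef coef′ : Fin k → Carrier} (b : Fin k → Vec) →
          (lin coef b +v lin coef′ b) ≈v lin (λ i → coef i +K coef′ i) b
  lin-+ {coef = coef} {coef′} b j =
    trans (ΣK-+ (λ i → coef i *K b i j) (λ i → coef′ i *K b i j))
          (ΣK-cong (λ i → sym (distribʳ (b i j) (coef i) (coef′ i))))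

  lin-• : ∀ {k} {coef : Fin k → Carrier} (b : Fin k → Vec) a →
          (a •v lin coef b) ≈v lin (λ i → a *K coef i) b
  lin-• {coef = coef} b a j =
    trans (ΣK-* a (λ i → coef i *K b i j)) (ΣK-cong (λ i → sym (*-assoc a (coef i) (b i j))))

  lin-neg : ∀ {k} {coef : Fin k → Carrier} (b : Fin k → Vec) →
            lin (λ i → - coef i) b ≈v (λ j → - lin coef b j)
  lin-neg {coef = coef} b j = begin
    lin (λ i → - coef i) b j         ≈⟨ lin-cong b (λ i → -1*x≈-x (coef i)) j ⟨
    lin (λ i → - 1# *K coef i) b j   ≈⟨ lin-• b (- 1#) j ⟨
    - 1# *K lin coef b j             ≈⟨ -1*x≈-x _ ⟩
    - lin coef b j                   ∎
    where open ≈-Reasoning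

  lin-zero : ∀ {k} {coef : Fin k → Carrier} (b : Fin k → Vec) →
             (∀ i → coef i ≈ 0#) → lin coef b ≈v 0v
  lin-zero b e j = ΣK-zero (λ i → trans (*-congʳ (e i)) (zeroˡ _))

  lin-⁅⁆ : ∀ {k} {coef : Fin k → Carrier} (b : Fin k → Vec) (i : Fin k) →
           (∀ j → j ∉ ⁅ i ⁆ → coef j ≈ 0#) → lin coef b ≈v (coef i •v b i)
  lin-⁅⁆ b i e l = ΣK-single i (λ j j≢i → trans (*-congʳ (e j (x≢y⇒x∉⁅y⁆ j≢i))) (zeroˡ _))

  restrict : Subset k → (Fin k → Carrier) → Fin k → Carrier
  restrict X coef i with i ∈? X
  ... | yes _ = coef i
  ... | no  _ = 0#

  restrict-∈ : ∀ {i} → i ∈ X → restrict X coef i ≈ coef i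
  restrict-∈ {X = X} {i = i} i∈X with i ∈? X
  ... | yes _   = refl
  ... | no  i∉X = ⊥-elim (i∉X i∈X)

  restrict-vanishes : ∀ {i} → (i ∈ X → coef i ≈ 0#) → restrict X coef i ≈ 0#
  restrict-vanishes {X = X} {i = i} h with i ∈? X
  ... | yes i∈X = h i∈X
  ... | no  _   = refl

  restrict-∉ : ∀ i → i ∉ X → restrict X coef i ≈ 0#
  restrict-∉ i i∉X = restrict-vanishes (⊥-elim ∘ i∉X)

  restrict-+-restrict-∁ : ∀ i → restrict X coef i +K restrict (∁ X) coef i ≈ coef i
  restrict-+-restrict-∁ {X = X} i with i ∈? X
  ... | yes i∈X = trans (+-congˡ (restrict-∉ i (x∈p⇒x∉∁p i∈X))) (+-identityʳ _)
  ... | no  i∉X = trans (+-identityˡ _) (restrict-∈ (x∉p⇒x∈∁p i∉X))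

  lin-restrict-⁅⁆ : ∀ {k} (b : Fin k → Vec) i a →
                    lin (restrict ⁅ i ⁆ (λ _ → a)) b ≈v (a •v b i)
  lin-restrict-⁅⁆ b i a l =
    trans (lin-⁅⁆ b i restrict-∉ l) (*-congʳ (restrict-∈ (x∈⁅x⁆ i)))

  lin-injective : Independent b → lin coef b ≈v lin coef′ b → ∀ i → coef i ≈ coef′ i
  lin-injective {b = b} {coef = coef} {coef′ = coef′} independent eq i =
    x∙y⁻¹≈ε⇒x≈y _ _ (independent difference (λ j j∉⊤ → ⊥-elim (j∉⊤ ∈⊤)) lin-difference≈0 i)
    where
    open ≈-Reasoning
    difference : Fin _ → Carrier
    difference i = coef i +K - coef′ i
    lin-difference≈0 : lin difference b ≈v 0v
    lin-difference≈0 j = begin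
      lin difference b j                         ≈⟨ lin-+ b j ⟨
      lin coef b j +K lin (λ i → - coef′ i) b j  ≈⟨ +-congˡ (lin-neg b j) ⟩
      lin coef b j +K - lin coef′ b j            ≈⟨ +-congʳ (eq j) ⟩
      lin coef′ b j +K - lin coef′ b j           ≈⟨ -‿inverseʳ _ ⟩
      0#                                         ∎

  lin-closed : ∀ W {k} {coef : Fin k → Carrier} {b : Fin k → Vec} →
               (∀ i → pred W (coef i •v b i)) → pred W (lin coef b)
  lin-closed W {zero}  h = has0 W
  lin-closed W {suc k} h = add W (h fzero) (lin-closed W (h ∘ fsuc))

  SpanIn-mono : X ⊆ Y → SpanIn b X ⊆S SpanIn b Y
  SpanIn-mono X⊆Y x (lift (coef , z , ex)) = lift (coef , (λ i i∉Y → z i (i∉Y ∘ X⊆Y)) , ex)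

  SpanIn-⊆ : (∀ i → i ∈ X → pred W (b i)) → SpanIn b X ⊆S W
  SpanIn-⊆ {X = X} {W = W} {b = b} b∈W x (lift (coef , z , ex)) =
    resp W (λ j → sym (ex j)) (lin-closed W term∈W)
    where
    term∈W : ∀ i → pred W (coef i •v b i)
    term∈W i with i ∈? X
    ... | yes i∈X = scale W (coef i) (b∈W i i∈X)
    ... | no  i∉X = resp W (λ j → sym (trans (*-congʳ (z i i∉X)) (zeroˡ _))) (has0 W)

  SpanIn-∩-⊆-∩S : ∀ X Y → SpanIn b (X ∩ Y) ⊆S (SpanIn b X ∩S SpanIn b Y)
  SpanIn-∩-⊆-∩S X Y x x∈span =
    SpanIn-mono (p∩q⊆p X Y) x x∈span , SpanIn-mono (p∩q⊆q X Y) x x∈span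

  SpanIn-⊆-+S : Z ⊆ X ∪ Y → SpanIn b Z ⊆S (SpanIn b X +S SpanIn b Y)
  SpanIn-⊆-+S {Z = Z} {X = X} {Y = Y} {b = b} Z⊆X∪Y x (lift (coef , z , ex)) =
    lin (restrict X coef) b , lin (restrict (∁ X) coef) b ,
    lift (restrict X coef , restrict-∉ , (λ _ → refl)) ,
    lift (restrict (∁ X) coef , vanishes-off-Y , (λ _ → refl)) ,
    λ j → trans (ex j) (sym (trans (lin-+ b j) (lin-cong b restrict-+-restrict-∁ j)))
    where
    vanishes-off-Y : ∀ i → i ∉ Y → restrict (∁ X) coef i ≈ 0#
    vanishes-off-Y i i∉Y = restrict-vanishes λ i∈∁X →
      z i λ i∈Z → [ x∈∁p⇒x∉p i∈∁X , i∉Y ]′ (x∈p∪q⁻ X Y (Z⊆X∪Y i∈Z))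

  SpanIn-∩S-∁-⊆-zeroS : Independent b → (SpanIn b X ∩S SpanIn b (∁ X)) ⊆S zeroS
  SpanIn-∩S-∁-⊆-zeroS {b = b} {X = X} independent x (lift (coef , z , ex) , lift (coef′ , z′ , ex′)) =
    lift (λ j → trans (ex j) (lin-zero b coef≈0 j))
    where
    coef≈coef′ : ∀ i → coef i ≈ coef′ i
    coef≈coef′ = lin-injective independent (λ j → trans (sym (ex j)) (ex′ j))
    coef≈0 : ∀ i → coef i ≈ 0#
    coef≈0 i with i ∈? X
    ... | yes i∈X = trans (coef≈coef′ i) (z′ i (x∈p⇒x∉∁p i∈X))
    ... | no  i∉X = z i i∉X

  fullS-⊆-SpanIn-+S-∁ : fullS ⊆S Span b → fullS ⊆S (SpanIn b X +S SpanIn b (∁ X))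
  fullS-⊆-SpanIn-+S-∁ {X = X} spans x x∈E =
    SpanIn-⊆-+S (⊆-reflexive (≡.sym (p∪∁p≡⊤ X))) x (spans x x∈E)

  IndependentIn-antimono : X ⊆ Y → IndependentIn b Y → IndependentIn b X
  IndependentIn-antimono X⊆Y independent coef z = independent coef (λ i i∉Y → z i (i∉Y ∘ X⊆Y))

  HasDim-SpanIn-Empty : Empty X → HasDim (SpanIn b X) 0
  HasDim-SpanIn-Empty {b = b} empty =
    (λ ()) , (λ ()) , (λ _ _ _ ()) ,
    λ x (lift (coef , z , ex)) →
      lift ((λ ()) , (λ ()) ,
            λ j → trans (ex j) (lin-zero b (λ i → z i (λ i∈X → empty (i , i∈X))) j))

  HasDim-SpanIn-⁅⁆ : ∀ i → IndependentIn b ⁅ i ⁆ → HasDim (SpanIn b ⁅ i ⁆) 1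
  HasDim-SpanIn-⁅⁆ {b = b} i independent =
    (λ _ → b i) , (λ _ _ → b-i∈span) , b-i-independent , spanning
    where
    b-i∈span : pred (SpanIn b ⁅ i ⁆) (b i)
    b-i∈span = lift (restrict ⁅ i ⁆ (λ _ → 1#) , restrict-∉ ,
                     λ l → sym (trans (lin-restrict-⁅⁆ b i 1# l) (*-identityˡ _)))
    b-i-independent : Independent (λ (_ : Fin 1) → b i)
    b-i-independent a _ a•b-i≈0 fzero =
      trans (sym (restrict-∈ (x∈⁅x⁆ i)))
        (independent (restrict ⁅ i ⁆ (λ _ → a fzero)) restrict-∉
          (λ l → trans (lin-restrict-⁅⁆ b i (a fzero) l) (trans (sym (+-identityʳ _)) (a•b-i≈0 l))) i)
    spanning : SpanIn b ⁅ i ⁆ ⊆S Span (λ (_ : Fin 1) → b i)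
    spanning x (lift (coef , z , ex)) =
      lift ((λ _ → coef i) , (λ j j∉⊤ → ⊥-elim (j∉⊤ ∈⊤)) ,
            λ l → trans (ex l) (trans (lin-⁅⁆ b i z l) (sym (+-identityʳ _))))

  IsKappa-minimal : ∀ {ρ t t′ A V A′ V′} →
                    IsKappa ρ t → VertSepQ ρ t A V → VertSepQ ρ t′ A′ V′ → t ≤ t′
  IsKappa-minimal (inj₁ (_ , minimal)) _   sep′ = minimal _ _ _ sep′
  IsKappa-minimal (inj₂ (none , _))    sep _    = ⊥-elim (none _ _ _ sep)

  module Rank (ρ : Subspace → ℕ) (isQ : IsQMatroid ρ) where
    open IsQMatroid isQ

    rank-cong : ∀ V W → V ⊆S W → W ⊆S V → ρ V ≡ ρ W
    rank-cong V W V⊆W W⊆V = ≤-antisym (rank-mono V W V⊆W) (rank-mono W V W⊆V)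

    rank-+S-≤ : ∀ V W → ρ (V +S W) ≤ ρ V + ρ W
    rank-+S-≤ V W = ≤-trans (m≤n+m _ _) (rank-submod V W)

    rank-SpanIn-basis : IsBasisIn W b X → ρ (SpanIn b X) ≡ ρ W
    rank-SpanIn-basis {W = W} {b = b} {X = X} (b∈W , _ , W⊆span) =
      rank-cong (SpanIn b X) W (SpanIn-⊆ {W = W} b∈W) W⊆span

    rank-SpanIn-≤-card : Independent b → ∀ X → ρ (SpanIn b X) ≤ ∣ X ∣
    rank-SpanIn-≤-card {b = b} independent X = go X (⊂-wellFounded X)
      where
      open ≤-Reasoning
      rank-⁅⁆≤1 : ∀ i → ρ (SpanIn b ⁅ i ⁆) ≤ 1
      rank-⁅⁆≤1 i =
        rank-≤-dim _ 1 (HasDim-SpanIn-⁅⁆ i (IndependentIn-antimono (λ _ → ∈⊤) independent))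
      go : ∀ X → Acc _⊂_ X → ρ (SpanIn b X) ≤ ∣ X ∣
      go X (acc smaller) with nonempty? X
      ... | no  empty     = ≤-trans (rank-≤-dim _ 0 (HasDim-SpanIn-Empty empty)) z≤n
      ... | yes (i , i∈X) = begin
        ρ (SpanIn b X)                             ≤⟨ rank-mono _ _ (SpanIn-⊆-+S (p⊆p-x∪⁅x⁆ X i)) ⟩
        ρ (SpanIn b (X - i) +S SpanIn b ⁅ i ⁆)     ≤⟨ rank-+S-≤ _ _ ⟩
        ρ (SpanIn b (X - i)) + ρ (SpanIn b ⁅ i ⁆)  ≤⟨ +-mono-≤ (go (X - i) (smaller (x∈p⇒p-x⊂p i∈X)))
                                                                (rank-⁅⁆≤1 i) ⟩
        ∣ X - i ∣ + 1                              ≡⟨ +-comm _ 1 ⟩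
        suc ∣ X - i ∣                              ≤⟨ x∈p⇒∣p-x∣<∣p∣ i∈X ⟩
        ∣ X ∣                                      ∎

    SpanIn-isMatroid : Independent b → IsMatroid (λ X → ρ (SpanIn b X))
    SpanIn-isMatroid independent = record
      { r-≤-card = rank-SpanIn-≤-card independent
      ; r-mono   = λ X Y X⊆Y → rank-mono _ _ (SpanIn-mono X⊆Y)
      ; r-submod = λ X Y → ≤-trans
          (+-mono-≤ (rank-mono _ _ (SpanIn-∩-⊆-∩S X Y)) (rank-mono _ _ (SpanIn-⊆-+S ⊆-refl)))
          (rank-submod _ _)
      }

    VertSepM⇒VertSepQ : ∀ {t} → IsBasisIn fullS b ⊤ → VertSepM (λ Y → ρ (SpanIn b Y)) t X →
                        VertSepQ ρ t (SpanIn b X) (SpanIn b (∁ X))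
    VertSepM⇒VertSepQ {b = b} {X = X} {t = t} basis@(_ , independent , spans) (sum< , t≤ , t≤′) =
      SpanIn-∩S-∁-⊆-zeroS independent , fullS-⊆-SpanIn-+S-∁ spans , t≤ , t≤′ ,
      ≡.subst (λ r → ρ (SpanIn b X) + ρ (SpanIn b (∁ X)) < t + r) (rank-SpanIn-basis basis) sum<

    VertSepQ⇒VertSepM : ∀ {t A V} →
                        IsBasisIn fullS b ⊤ → IsBasisIn A b X → IsBasisIn V b (∁ X) →
                        VertSepQ ρ t A V → VertSepM (λ Y → ρ (SpanIn b Y)) t X
    VertSepQ⇒VertSepM basisE basisA basisV (_ , _ , t≤ρA , t≤ρV , sum<)
      rewrite rank-SpanIn-basis basisE | rank-SpanIn-basis basisA | rank-SpanIn-basis basisV =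
      sum< , t≤ρA , t≤ρV

theorem5p12 : ∀ {c ℓ : Level} (F : FiniteField c ℓ) (n : ℕ)
    (ρ : QSpace.Subspace F n → ℕ) → QSpace.IsQMatroid F n ρ →
    (t : ℕ) → QSpace.IsKappa F n ρ t →
    (A V : QSpace.Subspace F n) → QSpace.VertSepQ F n ρ t A V →
    (s : ℕ) → QSpace.HasDim F n A s →
    (β : Fin n → QSpace.Vec F n) →
    QSpace.IsBasisIn F n (QSpace.fullS F n) β ⊤ →
    QSpace.IsBasisIn F n A β (QSpace.firstS F n s) →
    QSpace.IsBasisIn F n V β (∁ (QSpace.firstS F n s)) →
    IsMatroid (λ (X : Subset n) → ρ (QSpace.SpanIn F n β X))
      × IsVertConn (λ (X : Subset n) → ρ (QSpace.SpanIn F n β X)) t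
theorem5p12 F n ρ isQ t κ A V sep s _ β basisE basisA basisV =
  SpanIn-isMatroid (proj₁ (proj₂ basisE)) ,
  inj₁ ( (firstS s , VertSepQ⇒VertSepM basisE basisA basisV sep)
       , λ t′ X sepX → IsKappa-minimal κ sep (VertSepM⇒VertSepQ basisE sepX) )
  where
  open QSpace F n
  open SpanRank F n
  open Rank ρ isQ
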